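{- Let $\mathcal{SP}$ be the class of split graphs. For all integers $k\ge 0$ and $i$ such that $k+3\leq i\leq 2k+2$, we have $R_k^{\mathcal{SP}}(i,i)=3i-2k-4$.
   Context: All graphs are finite and simple. A graph is split if its vertex set can be partitioned into a clique and an independent set. For a graph $G$ and an integer $k\ge 0$, a $k$-sparse $j$-set is a set of exactly $j$ vertices of $G$ inducing a subgraph of maximum degree at most $k$; a $k$-dense $i$-set is a set of exactly $i$ vertices that is $k$-sparse in the complement of $G$. For a graph class $\mathcal{G}$, $R_k^{\mathcal{G}}(i,j)$ is the smallest natural number $n$ such that every graph on $n$ vertices in $\mathcal{G}$ has a $k$-dense $i$-set or a $k$-sparse $j$-set. -}

module Defs where

open import Data.Nat using (ℕ; _≤_; _<_)
open import Data.Bool using (Bool; true; false; not; if_then_else_)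
open import Data.Fin using (Fin; _≟_)
open import Data.Fin.Subset using (Subset; _∈_; _∉_; _∩_; ∣_∣)
open import Data.Vec using (tabulate)
open import Data.Product using (Σ; _×_; ∃)
open import Data.Sum using (_⊎_)
open import Relation.Nullary using (¬_)
open import Relation.Nullary.Decidable using (⌊_⌋)
open import Relation.Binary.PropositionalEquality using (_≡_; _≢_)

record Graph (n : ℕ) : Set where
  field
    adj   : Fin n → Fin n → Bool
    sym   : ∀ u v → adj u v ≡ adj v u
    loopless : ∀ v → adj v v ≡ false
open Graph public

complement : ∀ {n} → Graph n → Graph n
complement {n} G = record { adj = cadj ; sym = csym ; loopless = cloop }
  where
  cadj : Fin n → Fin n → Bool
  cadj u v = if ⌊ u ≟ v ⌋ then false else not (adj G u v)
  csym : ∀ u v → cadj u v ≡ cadj v u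
  csym u v with u ≟ v | v ≟ u
  ... | Relation.Nullary.yes _ | Relation.Nullary.yes _ = Relation.Binary.PropositionalEquality.refl
  ... | Relation.Nullary.yes p | Relation.Nullary.no q = Data.Empty.⊥-elim (q (Relation.Binary.PropositionalEquality.sym p))
    where import Data.Empty
  ... | Relation.Nullary.no p | Relation.Nullary.yes q = Data.Empty.⊥-elim (p (Relation.Binary.PropositionalEquality.sym q))
    where import Data.Empty
  ... | Relation.Nullary.no _ | Relation.Nullary.no _ = Relation.Binary.PropositionalEquality.cong not (sym G u v)
  cloop : ∀ v → cadj v v ≡ false
  cloop v with v ≟ v
  ... | Relation.Nullary.yes _ = Relation.Binary.PropositionalEquality.refl
  ... | Relation.Nullary.no p = Data.Empty.⊥-elim (p Relation.Binary.PropositionalEquality.refl)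
    where import Data.Empty

nbhd : ∀ {n} → Graph n → Fin n → Subset n
nbhd G v = tabulate (λ u → adj G v u)

IsSplit : ∀ {n} → Graph n → Set
IsSplit {n} G = Σ (Subset n) λ C → Σ (Subset n) λ I →
    (∀ v → (v ∈ C × v ∉ I) ⊎ (v ∉ C × v ∈ I))
  × (∀ u v → u ∈ C → v ∈ C → u ≢ v → adj G u v ≡ true)
  × (∀ u v → u ∈ I → v ∈ I → adj G u v ≡ false)

MaxDegInducedLe : ∀ {n} → Graph n → ℕ → Subset n → Set
MaxDegInducedLe G k S = ∀ v → v ∈ S → ∣ S ∩ nbhd G v ∣ ≤ k

HasSparseSet : ∀ {n} → Graph n → ℕ → ℕ → Set
HasSparseSet {n} G k j = Σ (Subset n) λ S → ∣ S ∣ ≡ j × MaxDegInducedLe G k S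

HasDenseSet : ∀ {n} → Graph n → ℕ → ℕ → Set
HasDenseSet G k i = HasSparseSet (complement G) k i

SplitRamseyProperty : ℕ → ℕ → ℕ → ℕ → Set
SplitRamseyProperty k i j n =
  (G : Graph n) → IsSplit G → HasDenseSet G k i ⊎ HasSparseSet G k j

SplitRamseyNumberIs : ℕ → ℕ → ℕ → ℕ → Set
SplitRamseyNumberIs k i j N =
  SplitRamseyProperty k i j N × (∀ m → m < N → ¬ SplitRamseyProperty k i j m)

-- Write i = k + 2 + t, so that 1 ≤ t ≤ k and 3i − 2k − 4 = i + 2t.
--
-- Let G be split, with clique C and independent set I, on i + 2t vertices. A side
-- with i vertices gives the required set directly. Otherwise a = i − |I| and a′ = i − |C|
-- satisfy a + a′ + t = k + 2. Adding to I any a clique vertices having at most k + 1 − a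
-- neighbours in I ("light" vertices) gives a k-sparse i-set, and dually in the complement. If
-- both sides lack light vertices, each of the p > 2t heavy clique vertices sees at least q − t
-- of the q > 2t heavy independent vertices, while each of the latter sees at most t heavy
-- clique vertices; double counting gives p(q − t) ≤ qt, which is impossible.
--
-- On i + 2t − 1 vertices, let the clique consist of a core of k + 1 − t vertices
-- and two hubs of t vertices, let the independent set consist of two leaf classes of t
-- vertices, and join each hub completely to its own leaf class. A k-sparse i-set has a clique
-- vertex outside the core, and a k-dense i-set has an independent vertex. The first misses at
-- most t vertices of I, the second at most t vertices of C in the complement, so either way
-- some vertex of the set has degree at least i − 1 − t = k + 1.

module Submission where

open import Data.Bool using (Bool; true; false; not; _∧_; _∨_; if_then_else_)
open import Data.Bool.Properties using (∧-zeroʳ; not-injective) renaming (_≟_ to _≟ᵇ_)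
open import Data.Empty using (⊥; ⊥-elim)
open import Data.Fin using (Fin; zero; suc; toℕ; _≟_)
open import Data.Fin.Properties using (any?; toℕ<n)
open import Data.Fin.Subset using (Subset; _∈_; _∉_; _∩_; ∣_∣)
open import Data.List using ([]) renaming (_∷_ to _∷ˡ_)
open import Data.Nat using (ℕ; zero; suc; _+_; _*_; _∸_; _≤_; _<_; z≤n; s≤s; _<ᵇ_; _≤?_; _<?_)
open import Data.Nat.Properties hiding (_≟_)
open import Data.Nat.Tactic.RingSolver using (solve; solve-∀)
open import Algebra.Properties.Semiring.Sum +-*-semiring
  using (sum; sum-syntax; ∑-comm; ∑-distrib-+; sum-cong-≗; *-distribʳ-sum)
open import Data.Product using (Σ; ∃; _×_; _,_; proj₁; proj₂)
open import Data.Sum using (_⊎_; inj₁; inj₂)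
import Data.Sum as ⊎
open import Data.Unit using (tt)
open import Data.Vec using ([]; lookup; tabulate) renaming (_∷_ to _∷ᵛ_)
open import Data.Vec.Functional using (_∷_)
open import Data.Vec.Properties using (lookup∘tabulate; lookup-zipWith; []=⇒lookup; lookup⇒[]=)
open import Function using (_∘_)
open import Relation.Binary.PropositionalEquality
open import Relation.Nullary using (¬_; Dec)
open import Relation.Nullary.Decidable using (⌊_⌋; yes; no)

open import Defs hiding (sym)

private
  variable
    m n : ℕ

∧-true⁺ : ∀ {a b} → a ≡ true → b ≡ true → a ∧ b ≡ true
∧-true⁺ refl refl = refl

∧-trueˡ : ∀ {a b} → a ∧ b ≡ true → a ≡ true
∧-trueˡ {true} _ = refl

∧-trueʳ : ∀ {a b} → a ∧ b ≡ true → b ≡ true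
∧-trueʳ {true} e = e

∨-true⁻ : ∀ {a b} → a ∨ b ≡ true → a ≡ true ⊎ b ≡ true
∨-true⁻ {true} _ = inj₁ refl
∨-true⁻ {false} e = inj₂ e

∨-trueˡ : ∀ {a b} → a ≡ true → a ∨ b ≡ true
∨-trueˡ refl = refl

∨-trueʳ : ∀ {a b} → b ≡ true → a ∨ b ≡ true
∨-trueʳ {true} _ = refl
∨-trueʳ {false} e = e

not-true⇒false : ∀ {a} → not a ≡ true → a ≡ false
not-true⇒false {false} _ = refl

true≢false : ∀ {a} → a ≡ true → a ≢ false
true≢false refl ()

⌊⌋-true : ∀ {P : Set} (d : Dec P) → ⌊ d ⌋ ≡ true → P
⌊⌋-true (yes p) _ = p

⌊⌋-false : ∀ {P : Set} (d : Dec P) → ⌊ d ⌋ ≡ false → ¬ P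
⌊⌋-false (no ¬p) _ = ¬p

-- Counting the points of a Boolean predicate on Fin n

_⊆ᵇ_ : (Fin n → Bool) → (Fin n → Bool) → Set
p ⊆ᵇ q = ∀ u → p u ≡ true → q u ≡ true

indicator : Bool → ℕ
indicator b = if b then 1 else 0

count : (Fin n → Bool) → ℕ
count {n} p = sum (λ u → indicator (p u))

count-cong : {p q : Fin n → Bool} → (∀ u → p u ≡ q u) → count p ≡ count q
count-cong p≗q = sum-cong-≗ (λ u → cong indicator (p≗q u))

count-false : ∀ n → count {n} (λ _ → false) ≡ 0
count-false zero = refl
count-false (suc n) = count-false n

count-true : ∀ n → count {n} (λ _ → true) ≡ n
count-true zero = refl
count-true (suc n) = cong suc (count-true n)

⁅_⁆ᵇ : Fin n → Fin n → Bool
⁅ v ⁆ᵇ u = ⌊ u ≟ v ⌋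

count-⁅⁆ : (v : Fin n) → count ⁅ v ⁆ᵇ ≡ 1
count-⁅⁆ {suc n} zero = cong suc (count-false n)
count-⁅⁆ {suc n} (suc v) = trans (count-cong ⁅suc⁆) (count-⁅⁆ v)
  where
  ⁅suc⁆ : ∀ u → ⁅ suc v ⁆ᵇ (suc u) ≡ ⁅ v ⁆ᵇ u
  ⁅suc⁆ u with u ≟ v
  ... | yes _ = refl
  ... | no _ = refl

sum-mono-≤ : {f g : Fin n → ℕ} → (∀ u → f u ≤ g u) → sum f ≤ sum g
sum-mono-≤ {zero} _ = z≤n
sum-mono-≤ {suc n} f≤g = +-mono-≤ (f≤g zero) (sum-mono-≤ (λ u → f≤g (suc u)))

count-mono : {p q : Fin n → Bool} → p ⊆ᵇ q → count p ≤ count q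
count-mono {p = p} {q} p⊆q = sum-mono-≤ (λ u → pointwise (p u) (q u) (p⊆q u))
  where
  pointwise : ∀ a b → (a ≡ true → b ≡ true) → indicator a ≤ indicator b
  pointwise true true _ = ≤-refl
  pointwise true false a⇒b with a⇒b refl
  ... | ()
  pointwise false _ _ = z≤n

count-≤-+ : {p q r : Fin n → Bool} → (∀ u → p u ≡ true → q u ≡ true ⊎ r u ≡ true) →
            count p ≤ count q + count r
count-≤-+ {p = p} {q} {r} cover =
  ≤-trans (sum-mono-≤ (λ u → pointwise (p u) (q u) (r u) (cover u)))
          (≤-reflexive (∑-distrib-+ (indicator ∘ q) (indicator ∘ r)))
  where
  pointwise : ∀ a b c → (a ≡ true → b ≡ true ⊎ c ≡ true) →
              indicator a ≤ indicator b + indicator c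
  pointwise false _ _ _ = z≤n
  pointwise true true _ _ = s≤s z≤n
  pointwise true false true _ = ≤-refl
  pointwise true false false cover with cover refl
  ... | inj₁ ()
  ... | inj₂ ()

count-+-≤ : {p q r : Fin n → Bool} → q ⊆ᵇ p → r ⊆ᵇ p → (∀ u → q u ≡ true → r u ≢ true) →
            count q + count r ≤ count p
count-+-≤ {p = p} {q} {r} q⊆p r⊆p disjoint =
  ≤-trans (≤-reflexive (sym (∑-distrib-+ (indicator ∘ q) (indicator ∘ r))))
          (sum-mono-≤ (λ u → pointwise (p u) (q u) (r u) (q⊆p u) (r⊆p u) (disjoint u)))
  where
  pointwise : ∀ a b c → (b ≡ true → a ≡ true) → (c ≡ true → a ≡ true) → (b ≡ true → c ≢ true) →
              indicator b + indicator c ≤ indicator a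
  pointwise _ true true _ _ disj = ⊥-elim (disj refl refl)
  pointwise a true false b⇒a _ _ rewrite b⇒a refl = ≤-refl
  pointwise a false true _ c⇒a _ rewrite c⇒a refl = ≤-refl
  pointwise _ false false _ _ _ = z≤n

count-≤-suc : {p q : Fin n → Bool} (v : Fin n) → (∀ u → p u ≡ true → u ≢ v → q u ≡ true) →
              count p ≤ suc (count q)
count-≤-suc {q = q} v cover =
  ≤-trans (count-≤-+ {r = ⁅ v ⁆ᵇ} split)
          (≤-reflexive (trans (cong (count q +_) (count-⁅⁆ v)) (+-comm (count q) 1)))
  where
  split : ∀ u → _ → q u ≡ true ⊎ ⁅ v ⁆ᵇ u ≡ true
  split u pu with u ≟ v
  ... | yes _ = inj₂ refl
  ... | no u≢v = inj₁ (cover u pu u≢v)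

count-< : {p q : Fin n → Bool} (v : Fin n) → q ⊆ᵇ p → p v ≡ true → q v ≡ false → count q < count p
count-< {p = p} {q} v q⊆p pv qv =
  ≤-trans (≤-reflexive (trans (+-comm 1 (count q)) (cong (count q +_) (sym (count-⁅⁆ v)))))
          (count-+-≤ q⊆p ⁅v⁆⊆p disjoint)
  where
  ⁅v⁆⊆p : ⁅ v ⁆ᵇ ⊆ᵇ p
  ⁅v⁆⊆p u _ with u ≟ v
  ... | yes refl = pv
  disjoint : ∀ u → q u ≡ true → ⁅ v ⁆ᵇ u ≢ true
  disjoint u qu _ with u ≟ v
  ... | yes refl = true≢false qu qv

count-∨ : {p q : Fin n → Bool} → (∀ u → p u ≡ true → q u ≢ true) →
          count (λ u → p u ∨ q u) ≡ count p + count q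
count-∨ {p = p} {q} disjoint =
  ≤-antisym (count-≤-+ {p = λ u → p u ∨ q u} (λ _ → ∨-true⁻))
            (count-+-≤ {p = λ u → p u ∨ q u} (λ _ → ∨-trueˡ) (λ _ → ∨-trueʳ) disjoint)

count-<⇒∃ : {p q : Fin n → Bool} → count q < count p → ∃ λ u → p u ≡ true × q u ≡ false
count-<⇒∃ {p = p} {q} q<p with any? (λ u → p u ∧ not (q u) ≟ᵇ true)
... | yes (u , e) = u , ∧-trueˡ e , not-true⇒false (∧-trueʳ {p u} e)
... | no ∄ = ⊥-elim (<⇒≱ q<p (count-mono p⊆q))
  where
  p⊆q : p ⊆ᵇ q
  p⊆q u pu with q u in e
  ... | true = refl
  ... | false = ⊥-elim (∄ (u , cong₂ (λ x y → x ∧ not y) pu e))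

count-shrink : (p : Fin n → Bool) {j : ℕ} → j ≤ count p →
               Σ (Fin n → Bool) λ q → q ⊆ᵇ p × count q ≡ j
count-shrink {n} p {zero} _ = (λ _ → false) , (λ _ ()) , count-false n
count-shrink {suc n} p {suc j} j<p with p zero in e
... | true with count-shrink (p ∘ suc) (≤-pred j<p)
...   | q , q⊆p , ∣q∣ = (true ∷ q) , (λ { zero _ → e ; (suc u) → q⊆p u }) , cong suc ∣q∣
count-shrink {suc n} p {suc j} j<p | false with count-shrink (p ∘ suc) j<p
...   | q , q⊆p , ∣q∣ = (false ∷ q) , (λ { zero () ; (suc u) → q⊆p u }) , ∣q∣

double-counting : (P : Fin m → Bool) (Q : Fin n → Bool) (E : Fin m → Fin n → Bool) {a c : ℕ} →
  (∀ u → P u ≡ true → a ≤ count (λ x → Q x ∧ E u x)) →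
  (∀ x → Q x ≡ true → count (λ u → P u ∧ E u x) ≤ c) →
  count P * a ≤ count Q * c
double-counting {m} {n} P Q E {a} {c} rows cols = begin
  count P * a                                           ≡⟨ *-distribʳ-sum a (indicator ∘ P) ⟩
  ∑[ u < m ] (indicator (P u) * a)                      ≤⟨ sum-mono-≤ row ⟩
  ∑[ u < m ] ∑[ x < n ] indicator (P u ∧ (Q x ∧ E u x)) ≡⟨ ∑-comm {m} {n} incidence ⟩
  ∑[ x < n ] ∑[ u < m ] indicator (P u ∧ (Q x ∧ E u x)) ≤⟨ sum-mono-≤ col ⟩
  ∑[ x < n ] (indicator (Q x) * c)                      ≡⟨ *-distribʳ-sum c (indicator ∘ Q) ⟨
  count Q * c                                           ∎
  where
  open ≤-Reasoning
  incidence : Fin m → Fin n → ℕ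
  incidence u x = indicator (P u ∧ (Q x ∧ E u x))
  row : ∀ u → indicator (P u) * a ≤ count (λ x → P u ∧ (Q x ∧ E u x))
  row u with P u in e
  ... | true = ≤-trans (≤-reflexive (*-identityˡ a)) (rows u e)
  ... | false = z≤n
  col : ∀ x → count (λ u → P u ∧ (Q x ∧ E u x)) ≤ indicator (Q x) * c
  col x with Q x in e
  ... | true = ≤-trans (cols x e) (≤-reflexive (sym (*-identityˡ c)))
  ... | false = ≤-reflexive (trans (count-cong (λ u → ∧-zeroʳ (P u))) (count-false m))

-- Stated with _<ᵇ_ so that in-range (suc lo) len (suc x) reduces to in-range lo len x.
in-range : ℕ → ℕ → ℕ → Bool
in-range lo len x = not (x <ᵇ lo) ∧ (x <ᵇ lo + len)

count-in-range : ∀ m lo len → count {m} (in-range lo len ∘ toℕ) ≤ len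
count-in-range zero lo len = z≤n
count-in-range (suc m) (suc lo) len = count-in-range m lo len
count-in-range (suc m) zero zero = ≤-reflexive (count-false m)
count-in-range (suc m) zero (suc len) = s≤s (count-in-range m zero len)

count-within-range : {P : Fin m → Bool} (lo len : ℕ) →
  (∀ u → P u ≡ true → lo ≤ toℕ u × toℕ u < lo + len) → count P ≤ len
count-within-range {m} {P} lo len P⊆range = ≤-trans (count-mono in-range⁺) (count-in-range m lo len)
  where
  <ᵇ-true : ∀ {x y} → x < y → (x <ᵇ y) ≡ true
  <ᵇ-true {x} {y} x<y with x <ᵇ y | <⇒<ᵇ x<y
  ... | true | _ = refl
  <ᵇ-false : ∀ {x y} → y ≤ x → (x <ᵇ y) ≡ false
  <ᵇ-false {x} {y} y≤x with x <ᵇ y | <ᵇ⇒< x y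
  ... | false | _ = refl
  ... | true | x<y = ⊥-elim (≤⇒≯ y≤x (x<y tt))
  in-range⁺ : P ⊆ᵇ (in-range lo len ∘ toℕ)
  in-range⁺ u Pu with P⊆range u Pu
  ... | lo≤u , u<hi = ∧-true⁺ (cong not (<ᵇ-false lo≤u)) (<ᵇ-true u<hi)

∣∣≡count : (S : Subset n) → ∣ S ∣ ≡ count (lookup S)
∣∣≡count [] = refl
∣∣≡count (true ∷ᵛ S) = cong suc (∣∣≡count S)
∣∣≡count (false ∷ᵛ S) = ∣∣≡count S

∣tabulate∣≡count : (p : Fin n → Bool) → ∣ tabulate p ∣ ≡ count p
∣tabulate∣≡count p = trans (∣∣≡count (tabulate p)) (count-cong (lookup∘tabulate p))

∈-tabulate⁻ : {p : Fin n → Bool} {v : Fin n} → v ∈ tabulate p → p v ≡ true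
∈-tabulate⁻ {p = p} {v} v∈ = trans (sym (lookup∘tabulate p v)) ([]=⇒lookup v∈)

∈-tabulate⁺ : {p : Fin n → Bool} {v : Fin n} → p v ≡ true → v ∈ tabulate p
∈-tabulate⁺ {p = p} {v} pv = lookup⇒[]= v (tabulate p) (trans (lookup∘tabulate p v) pv)

degree≡count : (G : Graph n) (S : Subset n) (v : Fin n) →
               ∣ S ∩ nbhd G v ∣ ≡ count (λ u → lookup S u ∧ adj G v u)
degree≡count G S v = trans (∣∣≡count (S ∩ nbhd G v)) (count-cong lookup-∩)
  where
  lookup-∩ : ∀ u → lookup (S ∩ nbhd G v) u ≡ lookup S u ∧ adj G v u
  lookup-∩ u = trans (lookup-zipWith _∧_ u S (nbhd G v))
                     (cong (lookup S u ∧_) (lookup∘tabulate (adj G v) u))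

adj-complement : (G : Graph n) {u v : Fin n} → u ≢ v → adj (complement G) u v ≡ not (adj G u v)
adj-complement G {u} {v} u≢v with u ≟ v
... | yes u≡v = ⊥-elim (u≢v u≡v)
... | no _ = refl

record SplitPartition (G : Graph n) : Set where
  field
    clique indep : Fin n → Bool
    disjoint     : ∀ u → clique u ≡ true → indep u ≢ true
    covering     : ∀ u → clique u ≡ true ⊎ indep u ≡ true
    clique-adj   : ∀ u v → clique u ≡ true → clique v ≡ true → u ≢ v → adj G u v ≡ true
    indep-nonadj : ∀ u v → indep u ≡ true → indep v ≡ true → adj G u v ≡ false

  count-clique+indep : count clique + count indep ≡ n
  count-clique+indep = ≤-antisym
    (≤-trans (count-+-≤ (λ _ _ → refl) (λ _ _ → refl) disjoint) (≤-reflexive (count-true n)))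
    (≤-trans (≤-reflexive (sym (count-true n))) (count-≤-+ (λ u _ → covering u)))

open SplitPartition

IsSplit⇒SplitPartition : {G : Graph n} → IsSplit G → SplitPartition G
IsSplit⇒SplitPartition (C , I , part , C-clique , I-indep) = record
  { clique       = lookup C
  ; indep        = lookup I
  ; disjoint     = disjoint′
  ; covering     = covering′
  ; clique-adj   = λ u v cu cv → C-clique u v (lookup⇒[]= u C cu) (lookup⇒[]= v C cv)
  ; indep-nonadj = λ u v iu iv → I-indep u v (lookup⇒[]= u I iu) (lookup⇒[]= v I iv)
  }
  where
  disjoint′ : ∀ u → lookup C u ≡ true → lookup I u ≢ true
  disjoint′ u cu iu with part u
  ... | inj₁ (_ , u∉I) = u∉I (lookup⇒[]= u I iu)
  ... | inj₂ (u∉C , _) = u∉C (lookup⇒[]= u C cu)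
  covering′ : ∀ u → lookup C u ≡ true ⊎ lookup I u ≡ true
  covering′ u with part u
  ... | inj₁ (u∈C , _) = inj₁ ([]=⇒lookup u∈C)
  ... | inj₂ (_ , u∈I) = inj₂ ([]=⇒lookup u∈I)

SplitPartition⇒IsSplit : {G : Graph n} → SplitPartition G → IsSplit G
SplitPartition⇒IsSplit sp =
  tabulate (clique sp) , tabulate (indep sp) , part ,
  (λ u v u∈C v∈C → clique-adj sp u v (∈-tabulate⁻ u∈C) (∈-tabulate⁻ v∈C)) ,
  (λ u v u∈I v∈I → indep-nonadj sp u v (∈-tabulate⁻ u∈I) (∈-tabulate⁻ v∈I))
  where
  part : ∀ v → (v ∈ tabulate (clique sp) × v ∉ tabulate (indep sp))
             ⊎ (v ∉ tabulate (clique sp) × v ∈ tabulate (indep sp))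
  part v with covering sp v
  ... | inj₁ cv = inj₁ (∈-tabulate⁺ cv , λ v∈I → disjoint sp v cv (∈-tabulate⁻ v∈I))
  ... | inj₂ iv = inj₂ ((λ v∈C → disjoint sp v (∈-tabulate⁻ v∈C) iv) , ∈-tabulate⁺ iv)

complement-partition : {G : Graph n} → SplitPartition G → SplitPartition (complement G)
complement-partition {G = G} sp = record
  { clique       = indep sp
  ; indep        = clique sp
  ; disjoint     = λ u iu cu → disjoint sp u cu iu
  ; covering     = λ u → ⊎.swap (covering sp u)
  ; clique-adj   = λ u v iu iv u≢v →
      trans (adj-complement G u≢v) (cong not (indep-nonadj sp u v iu iv))
  ; indep-nonadj = indep-nonadj′
  }
  where
  indep-nonadj′ : ∀ u v → clique sp u ≡ true → clique sp v ≡ true → adj (complement G) u v ≡ false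
  indep-nonadj′ u v cu cv with u ≟ v
  ... | yes refl = refl
  ... | no u≢v = cong not (clique-adj sp u v cu cv u≢v)

labelled-graph : {A : Set} (label : Fin n → A) (R : A → A → Bool) → (∀ x y → R x y ≡ R y x) → Graph n
labelled-graph {n} label R R-sym = record { adj = adjᴿ ; sym = adjᴿ-sym ; loopless = adjᴿ-loopless }
  where
  adjᴿ : Fin n → Fin n → Bool
  adjᴿ u v = if ⌊ u ≟ v ⌋ then false else R (label u) (label v)
  adjᴿ-sym : ∀ u v → adjᴿ u v ≡ adjᴿ v u
  adjᴿ-sym u v with u ≟ v | v ≟ u
  ... | yes _ | yes _ = refl
  ... | yes u≡v | no v≢u = ⊥-elim (v≢u (sym u≡v))
  ... | no u≢v | yes v≡u = ⊥-elim (u≢v (sym v≡u))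
  ... | no _ | no _ = R-sym (label u) (label v)
  adjᴿ-loopless : ∀ v → adjᴿ v v ≡ false
  adjᴿ-loopless v with v ≟ v
  ... | yes _ = refl
  ... | no v≢v = ⊥-elim (v≢v refl)

module _ {A : Set} (label : Fin n → A) (R : A → A → Bool) (R-sym : ∀ x y → R x y ≡ R y x) where

  adj-labelled : {u v : Fin n} → u ≢ v → adj (labelled-graph label R R-sym) u v ≡ R (label u) (label v)
  adj-labelled {u} {v} u≢v with u ≟ v
  ... | yes u≡v = ⊥-elim (u≢v u≡v)
  ... | no _ = refl

  labelled-split : (side : A → Bool) →
    (∀ x y → side x ≡ true → side y ≡ true → R x y ≡ true) →
    (∀ x y → side x ≡ false → side y ≡ false → R x y ≡ false) →
    SplitPartition (labelled-graph label R R-sym)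
  labelled-split side clique-R indep-R = record
    { clique       = side ∘ label
    ; indep        = not ∘ side ∘ label
    ; disjoint     = λ u Cu Iu → true≢false Cu (not-true⇒false Iu)
    ; covering     = covering′
    ; clique-adj   = λ u v Cu Cv u≢v → trans (adj-labelled u≢v) (clique-R _ _ Cu Cv)
    ; indep-nonadj = indep-nonadj′
    }
    where
    covering′ : ∀ u → side (label u) ≡ true ⊎ not (side (label u)) ≡ true
    covering′ u with side (label u)
    ... | true = inj₁ refl
    ... | false = inj₂ refl
    indep-nonadj′ : ∀ u v → not (side (label u)) ≡ true → not (side (label v)) ≡ true →
                    adj (labelled-graph label R R-sym) u v ≡ false
    indep-nonadj′ u v Iu Iv with u ≟ v
    ... | yes _ = refl
    ... | no _ = indep-R _ _ (not-true⇒false Iu) (not-true⇒false Iv)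

module _ {G : Graph n} (sp : SplitPartition G) where

  indep-degree : Fin n → ℕ
  indep-degree v = count (λ u → indep sp u ∧ adj G v u)

  sparse-clique∪indep : (k : ℕ) {A J : Fin n → Bool} → A ⊆ᵇ clique sp → J ⊆ᵇ indep sp →
    count A ≤ k → (∀ v → A v ≡ true → indep-degree v + count A ≤ suc k) →
    HasSparseSet G k (count A + count J)
  sparse-clique∪indep k {A} {J} A⊆C J⊆I ∣A∣≤k low-degree =
    S , trans (∣tabulate∣≡count A∪J) (count-∨ A∩J≡∅) , degree-bound
    where
    A∪J : Fin n → Bool
    A∪J u = A u ∨ J u
    S : Subset n
    S = tabulate A∪J
    A∩J≡∅ : ∀ u → A u ≡ true → J u ≢ true
    A∩J≡∅ u Au Ju = disjoint sp u (A⊆C u Au) (J⊆I u Ju)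
    in-S : ∀ u → lookup S u ≡ true → A u ≡ true ⊎ J u ≡ true
    in-S u Su = ∨-true⁻ (trans (sym (lookup∘tabulate A∪J u)) Su)
    degree-bound : MaxDegInducedLe G k S
    degree-bound v v∈S rewrite degree≡count G S v with in-S v ([]=⇒lookup v∈S)
    ... | inj₁ Av = ≤-pred (begin
      suc (count (λ u → lookup S u ∧ adj G v u))                         ≤⟨ s≤s (count-≤-+ cover) ⟩
      suc (count (λ u → A u ∧ adj G v u) + indep-degree v)               ≤⟨ +-monoˡ-≤ _ A-neighbours<A ⟩
      count A + indep-degree v                                           ≡⟨ +-comm (count A) _ ⟩
      indep-degree v + count A                                           ≤⟨ low-degree v Av ⟩
      suc k                                                              ∎)
      where
      open ≤-Reasoning
      cover : ∀ u → lookup S u ∧ adj G v u ≡ true →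
              A u ∧ adj G v u ≡ true ⊎ indep sp u ∧ adj G v u ≡ true
      cover u e with in-S u (∧-trueˡ e)
      ... | inj₁ Au = inj₁ (∧-true⁺ Au (∧-trueʳ e))
      ... | inj₂ Ju = inj₂ (∧-true⁺ (J⊆I u Ju) (∧-trueʳ e))
      A-neighbours<A : count (λ u → A u ∧ adj G v u) < count A
      A-neighbours<A = count-< v (λ _ → ∧-trueˡ) Av
        (trans (cong (A v ∧_) (loopless G v)) (∧-zeroʳ (A v)))
    ... | inj₂ Jv = ≤-trans (count-mono neighbour-in-A) ∣A∣≤k
      where
      neighbour-in-A : (λ u → lookup S u ∧ adj G v u) ⊆ᵇ A
      neighbour-in-A u e with in-S u (∧-trueˡ e)
      ... | inj₁ Au = Au
      ... | inj₂ Ju = ⊥-elim (true≢false (∧-trueʳ e) (indep-nonadj sp v u (J⊆I v Jv) (J⊆I u Ju)))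

  large-indep⇒sparse : (k i : ℕ) → i ≤ count (indep sp) → HasSparseSet G k i
  large-indep⇒sparse k i i≤∣I∣ with count-shrink (indep sp) i≤∣I∣
  ... | J , J⊆I , refl = subst (HasSparseSet G k) (cong (_+ count J) (count-false n))
    (sparse-clique∪indep k (λ _ ()) J⊆I (≤-trans (≤-reflexive (count-false n)) z≤n) (λ _ ()))

  -- A light vertex can join I together with a − 1 other clique vertices keeping degree ≤ k.
  light : ℕ → ℕ → Fin n → Bool
  light k a v = clique sp v ∧ ⌊ indep-degree v + a ≤? suc k ⌋

  heavy : ℕ → ℕ → Fin n → Bool
  heavy k a v = clique sp v ∧ not ⌊ indep-degree v + a ≤? suc k ⌋

  many-light⇒sparse : (k a : ℕ) → a ≤ k → a ≤ count (light k a) → HasSparseSet G k (a + count (indep sp))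
  many-light⇒sparse k a a≤k a≤∣light∣ with count-shrink (light k a) a≤∣light∣
  ... | A , A⊆light , refl = sparse-clique∪indep k (λ u Au → ∧-trueˡ (A⊆light u Au)) (λ _ Iu → Iu) a≤k
    (λ v Av → ⌊⌋-true (_ ≤? _) (∧-trueʳ (A⊆light v Av)))

  heavy⇒large-degree : {k a : ℕ} (v : Fin n) → heavy k a v ≡ true → suc k < indep-degree v + a
  heavy⇒large-degree v hv = ≰⇒> (⌊⌋-false (_ ≤? _) (not-true⇒false (∧-trueʳ hv)))

  heavy-or-light : (k a : ℕ) (u : Fin n) → clique sp u ≡ true → heavy k a u ≡ true ⊎ light k a u ≡ true
  heavy-or-light k a u cu with ⌊ indep-degree u + a ≤? suc k ⌋
  ... | true = inj₂ (∧-true⁺ cu refl)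
  ... | false = inj₁ (∧-true⁺ cu refl)

  count-heavy+light : (k a : ℕ) → count (heavy k a) + count (light k a) ≡ count (clique sp)
  count-heavy+light k a = ≤-antisym
    (count-+-≤ {p = clique sp} {heavy k a} {light k a} (λ _ → ∧-trueˡ) (λ _ → ∧-trueˡ)
      (λ u hu lu → true≢false (∧-trueʳ {clique sp u} lu) (not-true⇒false (∧-trueʳ {clique sp u} hu))))
    (count-≤-+ (heavy-or-light k a))

  few-light⇒many-heavy : {k a s : ℕ} → count (clique sp) ≡ a + s → count (light k a) < a →
                         s < count (heavy k a)
  few-light⇒many-heavy {k} {a} {s} ∣C∣ l<a = +-cancelˡ-< a s _ (begin-strict
    a + s                                  ≡⟨ ∣C∣ ⟨
    count (clique sp)                      ≡⟨ count-heavy+light k a ⟨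
    count (heavy k a) + count (light k a)  <⟨ +-monoʳ-< (count (heavy k a)) l<a ⟩
    count (heavy k a) + a                  ≡⟨ +-comm (count (heavy k a)) a ⟩
    a + count (heavy k a)                  ∎)
    where open ≤-Reasoning

  neighbours+non-neighbours≤clique : (x : Fin n) → indep sp x ≡ true →
    count (λ u → clique sp u ∧ adj G x u) + count (λ u → clique sp u ∧ adj (complement G) x u)
      ≤ count (clique sp)
  neighbours+non-neighbours≤clique x Ix =
    count-+-≤ {p = clique sp} (λ _ → ∧-trueˡ) (λ _ → ∧-trueˡ) exclusive
    where
    exclusive : ∀ u → clique sp u ∧ adj G x u ≡ true → clique sp u ∧ adj (complement G) x u ≢ true
    exclusive u e e′ = true≢false (∧-trueʳ {clique sp u} e′)
      (trans (adj-complement G x≢u) (cong not (∧-trueʳ {clique sp u} e)))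
      where
      x≢u : x ≢ u
      x≢u refl = disjoint sp x (∧-trueˡ e) Ix

-- The upper bound

o+n+p≡2+k⇒1+k<m+o⇒n+p≤m : ∀ {k m n o p} → o + n + p ≡ 2 + k → suc k < m + o → n + p ≤ m
o+n+p≡2+k⇒1+k<m+o⇒n+p≤m {k} {m} {n} {o} {p} balance 1+k<m+o = +-cancelˡ-≤ o (n + p) m (begin
  o + (n + p)  ≡⟨ +-assoc o n p ⟨
  o + n + p    ≡⟨ balance ⟩
  2 + k        ≤⟨ 1+k<m+o ⟩
  m + o        ≡⟨ +-comm m o ⟩
  o + m        ∎)
  where open ≤-Reasoning

m+o≤n+p⇒n≤q+o⇒m∸p≤q : ∀ {m n o p q} → m + o ≤ n + p → n ≤ q + o → m ∸ p ≤ q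
m+o≤n+p⇒n≤q+o⇒m∸p≤q {m} {n} {o} {p} {q} m+o≤n+p n≤q+o =
  m≤n+o⇒m∸n≤o m p (+-cancelʳ-≤ o m (p + q) (begin
  m + o        ≤⟨ m+o≤n+p ⟩
  n + p        ≤⟨ +-monoˡ-≤ p n≤q+o ⟩
  q + o + p    ≡⟨ solve (q ∷ˡ o ∷ˡ p ∷ˡ []) ⟩
  p + q + o    ∎))
  where open ≤-Reasoning

2t<p⇒2t<q⇒q*t<p*[q∸t] : ∀ {p q t} → t + t < p → t + t < q → q * t < p * (q ∸ t)
2t<p⇒2t<q⇒q*t<p*[q∸t] {p} {q} {t} 2t<p 2t<q with m≤n⇒∃[o]m+o≡n 2t<q
... | w , refl = begin-strict
  (suc (t + t) + w) * t                          ≡⟨ cong (_* t) q≡t+r ⟩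
  (t + r) * t                                    <⟨ s≤s (m≤m+n _ _) ⟩
  suc ((t + r) * t + (t + t + w * suc t))        ≡⟨ expand t w ⟨
  suc (t + t) * r                                ≤⟨ *-monoˡ-≤ r 2t<p ⟩
  p * r                                          ≡⟨ cong (p *_) r≡q∸t ⟩
  p * (suc (t + t) + w ∸ t)                      ∎
  where
  open ≤-Reasoning
  r : ℕ
  r = suc t + w
  q≡t+r : suc (t + t) + w ≡ t + r
  q≡t+r = trans (cong suc (+-assoc t t w)) (sym (+-suc t (t + w)))
  expand : ∀ t w → suc (t + t) * (suc t + w) ≡ suc ((t + (suc t + w)) * t + (t + t + w * suc t))
  expand = solve-∀
  r≡q∸t : r ≡ suc (t + t) + w ∸ t
  r≡q∸t = trans (sym (m+n∸m≡n t r)) (cong (_∸ t) (sym q≡t+r))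

deficit-balance : ∀ {k t s a a′} → s ≡ a′ + (t + t) → s + a ≡ 2 + k + t → a + a′ + t ≡ 2 + k
deficit-balance {k} {t} {s} {a} {a′} refl s+a≡i = +-cancelʳ-≡ t _ _ (begin
  a + a′ + t + t          ≡⟨ solve (a ∷ˡ a′ ∷ˡ t ∷ˡ []) ⟩
  a′ + (t + t) + a        ≡⟨ s+a≡i ⟩
  2 + k + t               ∎)
  where open ≡-Reasoning

deficit-size : ∀ {k t s a a′} → s ≡ a′ + (t + t) → a + a′ + t ≡ 2 + k → a + s ≡ 2 + k + t
deficit-size {k} {t} {s} {a} {a′} refl balance = begin
  a + (a′ + (t + t))      ≡⟨ solve (a ∷ˡ a′ ∷ˡ t ∷ˡ []) ⟩
  a + a′ + t + t          ≡⟨ cong (_+ t) balance ⟩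
  2 + k + t               ∎
  where open ≡-Reasoning

balance⇒≤ : ∀ {k t a a′} → 1 ≤ t → 1 ≤ a′ → a + a′ + t ≡ 2 + k → a ≤ k
balance⇒≤ {k} {t} {a} {a′} 1≤t 1≤a′ balance = ≤-pred (≤-pred (begin
  2 + a                   ≡⟨ solve (a ∷ˡ []) ⟩
  a + 1 + 1               ≤⟨ +-mono-≤ (+-monoʳ-≤ a 1≤a′) 1≤t ⟩
  a + a′ + t              ≡⟨ balance ⟩
  2 + k                   ∎))
  where open ≤-Reasoning

-- a = i − |I| and a′ = i − |C| are the shortfalls of the two sides, where i = 2 + k + t.
module _ {G : Graph n} (sp : SplitPartition G) {k a a′ t : ℕ}
         (balance : a + a′ + t ≡ 2 + k)
         (∣C∣ : count (clique sp) ≡ a + (t + t)) (∣I∣ : count (indep sp) ≡ a′ + (t + t)) where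

  private
    sp′ : SplitPartition (complement G)
    sp′ = complement-partition sp

    heavyᶜ heavyⁱ : Fin n → Bool
    heavyᶜ = heavy sp k a
    heavyⁱ = heavy sp′ k a′

  heavy-rows : ∀ u → heavyᶜ u ≡ true → count heavyⁱ ∸ t ≤ count (λ x → heavyⁱ x ∧ adj G u x)
  heavy-rows u hu = m+o≤n+p⇒n≤q+o⇒m∸p≤q {o = count (light sp′ k a′)}
    (≤-reflexive (trans (count-heavy+light sp′ k a′) (trans ∣I∣ (sym (+-assoc a′ t t)))))
    (≤-trans (o+n+p≡2+k⇒1+k<m+o⇒n+p≤m balance (heavy⇒large-degree sp u hu)) (count-≤-+ cover))
    where
    cover : ∀ x → indep sp x ∧ adj G u x ≡ true →
            heavyⁱ x ∧ adj G u x ≡ true ⊎ light sp′ k a′ x ≡ true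
    cover x e with heavy-or-light sp′ k a′ x (∧-trueˡ e)
    ... | inj₁ hx = inj₁ (∧-true⁺ hx (∧-trueʳ {indep sp x} e))
    ... | inj₂ lx = inj₂ lx

  heavy-cols : ∀ x → heavyⁱ x ≡ true → count (λ u → heavyᶜ u ∧ adj G u x) ≤ t
  heavy-cols x hx = begin
    count (λ u → heavyᶜ u ∧ adj G u x)       ≤⟨ count-mono neighbour ⟩
    neighbours                               ≤⟨ +-cancelʳ-≤ (a + t) neighbours t (begin
      neighbours + (a + t)                       ≤⟨ +-monoʳ-≤ neighbours codegree ⟩
      neighbours + indep-degree sp′ x            ≤⟨ neighbours+non-neighbours≤clique sp x (∧-trueˡ hx) ⟩
      count (clique sp)                          ≡⟨ trans ∣C∣ (solve (a ∷ˡ t ∷ˡ [])) ⟩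
      t + (a + t)                                ∎) ⟩
    t                                        ∎
    where
    open ≤-Reasoning
    neighbours : ℕ
    neighbours = count (λ u → clique sp u ∧ adj G x u)
    codegree : a + t ≤ indep-degree sp′ x
    codegree = o+n+p≡2+k⇒1+k<m+o⇒n+p≤m (trans (cong (_+ t) (+-comm a′ a)) balance)
                                       (heavy⇒large-degree sp′ x hx)
    neighbour : (λ u → heavyᶜ u ∧ adj G u x) ⊆ᵇ (λ u → clique sp u ∧ adj G x u)
    neighbour u e = ∧-true⁺ (∧-trueˡ (∧-trueˡ {heavyᶜ u} e))
                            (trans (Graph.sym G x u) (∧-trueʳ {heavyᶜ u} e))

  few-light-on-both-sides-impossible : count (light sp k a) < a → count (light sp′ k a′) < a′ → ⊥
  few-light-on-both-sides-impossible few few′ =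
    <⇒≱ (2t<p⇒2t<q⇒q*t<p*[q∸t] (few-light⇒many-heavy sp ∣C∣ few)
                                (few-light⇒many-heavy sp′ ∣I∣ few′))
        (double-counting heavyᶜ heavyⁱ (adj G) heavy-rows heavy-cols)

  sparse-or-dense : 1 ≤ t → 1 ≤ a → 1 ≤ a′ → HasDenseSet G k (2 + k + t) ⊎ HasSparseSet G k (2 + k + t)
  sparse-or-dense 1≤t 1≤a 1≤a′ with a ≤? count (light sp k a) | a′ ≤? count (light sp′ k a′)
  ... | yes many | _ = inj₂ (subst (HasSparseSet G k) (deficit-size ∣I∣ balance)
        (many-light⇒sparse sp k a (balance⇒≤ 1≤t 1≤a′ balance) many))
  ... | no _ | yes many′ = inj₁ (subst (HasSparseSet (complement G) k) (deficit-size ∣C∣ balance′)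
        (many-light⇒sparse sp′ k a′ (balance⇒≤ 1≤t 1≤a balance′) many′))
    where
    balance′ : a′ + a + t ≡ 2 + k
    balance′ = trans (cong (_+ t) (+-comm a′ a)) balance
  ... | no few | no few′ = ⊥-elim (few-light-on-both-sides-impossible (≰⇒> few) (≰⇒> few′))

m+n≡o+p⇒m+q≡o⇒n≡q+p : ∀ {m n o p q} → m + n ≡ o + p → m + q ≡ o → n ≡ q + p
m+n≡o+p⇒m+q≡o⇒n≡q+p {m} {n} {o} {p} {q} m+n≡o+p refl =
  +-cancelˡ-≡ m n (q + p) (trans m+n≡o+p (+-assoc m q p))

split-sparse-or-dense : {G : Graph n} (sp : SplitPartition G) (k t : ℕ) → 1 ≤ t → n ≡ 2 + k + t + (t + t) →
  HasDenseSet G k (2 + k + t) ⊎ HasSparseSet G k (2 + k + t)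
split-sparse-or-dense sp k t 1≤t n≡ with 2 + k + t ≤? count (indep sp) | 2 + k + t ≤? count (clique sp)
... | yes i≤s | _ = inj₂ (large-indep⇒sparse sp k _ i≤s)
... | no _ | yes i≤c = inj₁ (large-indep⇒sparse (complement-partition sp) k _ i≤c)
... | no s≱i | no c≱i with m≤n⇒∃[o]m+o≡n (≰⇒> s≱i) | m≤n⇒∃[o]m+o≡n (≰⇒> c≱i)
... | o , 1+s+o≡i | o′ , 1+c+o′≡i = sparse-or-dense sp balance ∣C∣ ∣I∣ 1≤t (s≤s z≤n) (s≤s z≤n)
  where
  s c : ℕ
  s = count (indep sp)
  c = count (clique sp)
  c+s≡n : c + s ≡ 2 + k + t + (t + t)
  c+s≡n = trans (count-clique+indep sp) n≡
  ∣C∣ : c ≡ suc o + (t + t)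
  ∣C∣ = m+n≡o+p⇒m+q≡o⇒n≡q+p (trans (+-comm s c) c+s≡n) (trans (+-suc s o) 1+s+o≡i)
  ∣I∣ : s ≡ suc o′ + (t + t)
  ∣I∣ = m+n≡o+p⇒m+q≡o⇒n≡q+p c+s≡n (trans (+-suc c o′) 1+c+o′≡i)
  balance : suc o + suc o′ + t ≡ 2 + k
  balance = deficit-balance ∣I∣ (trans (+-suc s o) 1+s+o≡i)

upper-bound : (k t : ℕ) → 1 ≤ t → SplitRamseyProperty k (2 + k + t) (2 + k + t) (2 + k + t + (t + t))
upper-bound k t 1≤t G split = split-sparse-or-dense (IsSplit⇒SplitPartition {G = G} split) k t 1≤t refl

-- The lower bound

module _ {G : Graph n} (sp : SplitPartition G) where

  no-sparse-set : (k t : ℕ) (K : Fin n → Bool) → count K + count (indep sp) < 2 + k + t →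
    (∀ v → clique sp v ≡ true → K v ≡ false → count (λ u → indep sp u ∧ not (adj G v u)) ≤ t) →
    ¬ HasSparseSet G k (2 + k + t)
  no-sparse-set k t K small almost-complete (S , ∣S∣ , max-degree) = <-irrefl refl (begin
    2 + k + t                              ≤⟨ ∣S∣≤ ⟩
    count S∩C + count S∩I                  ≤⟨ +-mono-≤ S∩C≤ S∩I≤ ⟩
    suc neighbours-C + (neighbours-I + t)  ≡⟨ cong suc (+-assoc neighbours-C neighbours-I t) ⟨
    suc (neighbours-C + neighbours-I) + t  ≤⟨ +-monoˡ-≤ t (s≤s degree≤k) ⟩
    suc k + t                              ∎)
    where
    open ≤-Reasoning
    S∩C S∩I : Fin n → Bool
    S∩C u = lookup S u ∧ clique sp u
    S∩I u = lookup S u ∧ indep sp u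
    ∣S∣≤ : 2 + k + t ≤ count S∩C + count S∩I
    ∣S∣≤ = ≤-trans (≤-reflexive (trans (sym ∣S∣) (∣∣≡count S)))
      (count-≤-+ {p = lookup S} (λ u Su → ⊎.map (∧-true⁺ Su) (∧-true⁺ Su) (covering sp u)))
    K<S∩C : count K < count S∩C
    K<S∩C = +-cancelʳ-< (count (indep sp)) (count K) (count S∩C) (<-≤-trans small
      (≤-trans ∣S∣≤ (+-monoʳ-≤ (count S∩C) (count-mono (λ u → ∧-trueʳ {lookup S u})))))
    witness : ∃ λ v → S∩C v ≡ true × K v ≡ false
    witness = count-<⇒∃ K<S∩C
    v : Fin n
    v = proj₁ witness
    Sv : lookup S v ≡ true
    Sv = ∧-trueˡ (proj₁ (proj₂ witness))
    Cv : clique sp v ≡ true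
    Cv = ∧-trueʳ {lookup S v} (proj₁ (proj₂ witness))
    neighbours-C neighbours-I : ℕ
    neighbours-C = count (λ u → S∩C u ∧ adj G v u)
    neighbours-I = count (λ u → S∩I u ∧ adj G v u)
    S∩C≤ : count S∩C ≤ suc neighbours-C
    S∩C≤ = count-≤-suc v λ u e u≢v →
      ∧-true⁺ e (clique-adj sp v u Cv (∧-trueʳ {lookup S u} e) (u≢v ∘ sym))
    S∩I≤ : count S∩I ≤ neighbours-I + t
    S∩I≤ = ≤-trans (count-≤-+ indep-cover)
                   (+-monoʳ-≤ neighbours-I (almost-complete v Cv (proj₂ (proj₂ witness))))
      where
      indep-cover : ∀ u → S∩I u ≡ true →
                    S∩I u ∧ adj G v u ≡ true ⊎ indep sp u ∧ not (adj G v u) ≡ true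
      indep-cover u e with adj G v u
      ... | true = inj₁ (∧-true⁺ e refl)
      ... | false = inj₂ (∧-true⁺ (∧-trueʳ {lookup S u} e) refl)
    degree≤k : neighbours-C + neighbours-I ≤ k
    degree≤k = ≤-trans
      (count-+-≤ {p = λ u → lookup S u ∧ adj G v u}
        (λ u e → ∧-true⁺ (∧-trueˡ (∧-trueˡ e)) (∧-trueʳ {S∩C u} e))
        (λ u e → ∧-true⁺ (∧-trueˡ (∧-trueˡ e)) (∧-trueʳ {S∩I u} e))
        (λ u e e′ → disjoint sp u (∧-trueʳ {lookup S u} (∧-trueˡ e))
                                   (∧-trueʳ {lookup S u} (∧-trueˡ e′))))
      (≤-trans (≤-reflexive (sym (degree≡count G S v))) (max-degree v (lookup⇒[]= v S Sv)))

data Part : Set where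
  core     : Part
  hub leaf : Bool → Part

clique-part : Part → Bool
clique-part (leaf _) = false
clique-part _        = true

core-part : Part → Bool
core-part core = true
core-part _    = false

part-adj : Part → Part → Bool
part-adj (hub b)  (leaf c) = ⌊ b ≟ᵇ c ⌋
part-adj (leaf b) (hub c)  = ⌊ b ≟ᵇ c ⌋
part-adj x        y        = clique-part x ∧ clique-part y

part-adj-sym : ∀ x y → part-adj x y ≡ part-adj y x
part-adj-sym core     core     = refl
part-adj-sym core     (hub _)  = refl
part-adj-sym core     (leaf _) = refl
part-adj-sym (hub _)  core     = refl
part-adj-sym (hub _)  (hub _)  = refl
part-adj-sym (hub b)  (leaf c) = ≟ᵇ-sym b c
  where
  ≟ᵇ-sym : ∀ b c → ⌊ b ≟ᵇ c ⌋ ≡ ⌊ c ≟ᵇ b ⌋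
  ≟ᵇ-sym false false = refl
  ≟ᵇ-sym false true  = refl
  ≟ᵇ-sym true  false = refl
  ≟ᵇ-sym true  true  = refl
part-adj-sym (leaf _) core     = refl
part-adj-sym (leaf b) (hub c)  = sym (part-adj-sym (hub c) (leaf b))
part-adj-sym (leaf _) (leaf _) = refl

clique-non-core⇒hub : ∀ τ → clique-part τ ≡ true → core-part τ ≡ false → ∃ λ b → τ ≡ hub b
clique-non-core⇒hub (hub b) _ _ = b , refl

core-part⇒core : ∀ τ → core-part τ ≡ true → τ ≡ core
core-part⇒core core _ = refl

indep⇒leaf : ∀ τ → clique-part τ ≡ false → ∃ λ b → τ ≡ leaf b
indep⇒leaf (leaf b) _ = b , refl

hub-non-neighbour : ∀ b τ → clique-part τ ≡ false → part-adj (hub b) τ ≡ false → τ ≡ leaf (not b)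
hub-non-neighbour false (leaf true)  _ _ = refl
hub-non-neighbour true  (leaf false) _ _ = refl

leaf-neighbour : ∀ b τ → clique-part τ ≡ true → part-adj (leaf b) τ ≡ true → τ ≡ hub b
leaf-neighbour false (hub false) _ _ = refl
leaf-neighbour true  (hub true)  _ _ = refl

-- The graph of the lower bound for L = k + 1 − t, truncated to its first m vertices, which are
-- numbered block by block: core, hub true, hub false, leaf true, leaf false.
module Construction (L t : ℕ) where

  part : ℕ → Part
  part x with x <? L
  ... | yes _ = core
  ... | no _ with x <? L + t
  ...   | yes _ = hub true
  ...   | no _ with x <? L + (t + t)
  ...     | yes _ = hub false
  ...     | no _ with x <? L + (t + t) + t
  ...       | yes _ = leaf true
  ...       | no _ = leaf false

  start size : Part → ℕ
  start core         = 0
  start (hub true)   = L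
  start (hub false)  = L + t
  start (leaf true)  = L + (t + t)
  start (leaf false) = L + (t + t) + t
  size core     = L
  size (hub _)  = t
  size (leaf _) = t

  part-range : ∀ x → x < L + (t + t) + (t + t) → start (part x) ≤ x × x < start (part x) + size (part x)
  part-range x x<N with x <? L
  ... | yes x<L = z≤n , x<L
  ... | no x≮L with x <? L + t
  ...   | yes x<L+t = ≮⇒≥ x≮L , x<L+t
  ...   | no x≮L+t with x <? L + (t + t)
  ...     | yes x<L+2t = ≮⇒≥ x≮L+t , subst (x <_) (sym (+-assoc L t t)) x<L+2t
  ...     | no x≮L+2t with x <? L + (t + t) + t
  ...       | yes x<L+3t = ≮⇒≥ x≮L+2t , x<L+3t
  ...       | no x≮L+3t = ≮⇒≥ x≮L+3t , subst (x <_) (sym (+-assoc (L + (t + t)) t t)) x<N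

  module _ {m : ℕ} (m≤N : m ≤ L + (t + t) + (t + t)) where

    label : Fin m → Part
    label u = part (toℕ u)

    graph : Graph m
    graph = labelled-graph label part-adj part-adj-sym

    partition : SplitPartition graph
    partition = labelled-split label part-adj part-adj-sym clique-part clique-adj′ indep-nonadj′
      where
      clique-adj′ : ∀ x y → clique-part x ≡ true → clique-part y ≡ true → part-adj x y ≡ true
      clique-adj′ core    core    _ _ = refl
      clique-adj′ core    (hub _) _ _ = refl
      clique-adj′ (hub _) core    _ _ = refl
      clique-adj′ (hub _) (hub _) _ _ = refl
      indep-nonadj′ : ∀ x y → clique-part x ≡ false → clique-part y ≡ false → part-adj x y ≡ false
      indep-nonadj′ (leaf _) (leaf _) _ _ = refl

    label-range : ∀ u → start (label u) ≤ toℕ u × toℕ u < start (label u) + size (label u)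
    label-range u = part-range (toℕ u) (<-≤-trans (toℕ<n u) m≤N)

    count-part : (τ : Part) {P : Fin m → Bool} → (∀ u → P u ≡ true → label u ≡ τ) → count P ≤ size τ
    count-part τ P⇒τ = count-within-range (start τ) (size τ) λ u Pu →
      subst (λ σ → start σ ≤ toℕ u × toℕ u < start σ + size σ) (P⇒τ u Pu) (label-range u)

    count-clique : count (clique partition) ≤ L + (t + t)
    count-clique = count-within-range 0 (L + (t + t)) λ u Cu →
      z≤n , <-≤-trans (proj₂ (label-range u)) (clique-end (label u) Cu)
      where
      clique-end : ∀ τ → clique-part τ ≡ true → start τ + size τ ≤ L + (t + t)
      clique-end core         _ = m≤m+n L (t + t)
      clique-end (hub true)   _ = +-monoʳ-≤ L (m≤n+m t t)
      clique-end (hub false)  _ = ≤-reflexive (+-assoc L t t)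

    count-indep : count (indep partition) ≤ t + t
    count-indep = count-within-range (L + (t + t)) (t + t) λ u Iu →
      ≤-trans (indep-start (label u) (not-true⇒false Iu)) (proj₁ (label-range u)) ,
      <-≤-trans (toℕ<n u) m≤N
      where
      indep-start : ∀ τ → clique-part τ ≡ false → L + (t + t) ≤ start τ
      indep-start (leaf true)  _ = ≤-refl
      indep-start (leaf false) _ = m≤m+n (L + (t + t)) t

    hub-almost-complete : ∀ v → clique partition v ≡ true → core-part (label v) ≡ false →
      count (λ u → indep partition u ∧ not (adj graph v u)) ≤ t
    hub-almost-complete v Cv ¬core = count-part (leaf (not b)) non-neighbour-is-leaf
      where
      hub-label : ∃ λ b → label v ≡ hub b
      hub-label = clique-non-core⇒hub (label v) Cv ¬core
      b : Bool
      b = proj₁ hub-label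
      non-neighbour-is-leaf : ∀ u → indep partition u ∧ not (adj graph v u) ≡ true → label u ≡ leaf (not b)
      non-neighbour-is-leaf u e = hub-non-neighbour b (label u) (not-true⇒false (∧-trueˡ e)) (begin
        part-adj (hub b) (label u)     ≡⟨ cong (λ σ → part-adj σ (label u)) (proj₂ hub-label) ⟨
        part-adj (label v) (label u)   ≡⟨ adj-labelled label part-adj part-adj-sym v≢u ⟨
        adj graph v u                  ≡⟨ not-true⇒false (∧-trueʳ {indep partition u} e) ⟩
        false                          ∎)
        where
        open ≡-Reasoning
        v≢u : v ≢ u
        v≢u refl = disjoint partition v Cv (∧-trueˡ e)

    leaf-almost-complete : ∀ x → indep partition x ≡ true →
      count (λ u → clique partition u ∧ not (adj (complement graph) x u)) ≤ t
    leaf-almost-complete x Ix = count-part (hub b) neighbour-is-hub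
      where
      leaf-label : ∃ λ b → label x ≡ leaf b
      leaf-label = indep⇒leaf (label x) (not-true⇒false Ix)
      b : Bool
      b = proj₁ leaf-label
      neighbour-is-hub : ∀ u → clique partition u ∧ not (adj (complement graph) x u) ≡ true →
                         label u ≡ hub b
      neighbour-is-hub u e = leaf-neighbour b (label u) (∧-trueˡ e) (begin
        part-adj (leaf b) (label u)    ≡⟨ cong (λ σ → part-adj σ (label u)) (proj₂ leaf-label) ⟨
        part-adj (label x) (label u)   ≡⟨ adj-labelled label part-adj part-adj-sym x≢u ⟨
        adj graph x u                  ≡⟨ not-injective (trans (sym (adj-complement graph x≢u)) ¬coadj) ⟩
        true                           ∎)
        where
        open ≡-Reasoning
        ¬coadj : adj (complement graph) x u ≡ false
        ¬coadj = not-true⇒false (∧-trueʳ {clique partition u} e)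
        x≢u : x ≢ u
        x≢u refl = disjoint partition x (∧-trueˡ e) Ix

    no-sparse-or-dense : (k : ℕ) → L + t ≡ suc k →
      ¬ (HasDenseSet graph k (2 + k + t) ⊎ HasSparseSet graph k (2 + k + t))
    no-sparse-or-dense k L+t≡1+k = ⊎.[ no-dense , no-sparse ]
      where
      L+2t<i : L + (t + t) < 2 + k + t
      L+2t<i = ≤-reflexive (cong suc (trans (sym (+-assoc L t t)) (cong (_+ t) L+t≡1+k)))
      no-dense : ¬ HasDenseSet graph k (2 + k + t)
      no-dense = no-sparse-set (complement-partition partition) k t (λ _ → false)
        (<-≤-trans (s≤s (+-mono-≤ (≤-reflexive (count-false m)) count-clique)) L+2t<i)
        (λ x Ix _ → leaf-almost-complete x Ix)
      no-sparse : ¬ HasSparseSet graph k (2 + k + t)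
      no-sparse = no-sparse-set partition k t (core-part ∘ label)
        (<-≤-trans (s≤s (+-mono-≤ (count-part core (λ u → core-part⇒core (label u))) count-indep)) L+2t<i)
        hub-almost-complete

lower-bound : (k t : ℕ) → t ≤ suc k → ∀ m → m < 2 + k + t + (t + t) →
  ¬ SplitRamseyProperty k (2 + k + t) (2 + k + t) m
lower-bound k t t≤1+k m m<N property =
  no-sparse-or-dense m≤N k L+t≡1+k (property (graph m≤N) (SplitPartition⇒IsSplit (partition m≤N)))
  where
  L : ℕ
  L = suc k ∸ t
  open Construction L t
  L+t≡1+k : L + t ≡ suc k
  L+t≡1+k = m∸n+n≡m t≤1+k
  m≤N : m ≤ L + (t + t) + (t + t)
  m≤N = ≤-pred (≤-trans m<N (≤-reflexive (cong suc (begin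
    suc k + t + (t + t)       ≡⟨ cong (λ x → x + t + (t + t)) L+t≡1+k ⟨
    L + t + t + (t + t)       ≡⟨ cong (_+ (t + t)) (+-assoc L t t) ⟩
    L + (t + t) + (t + t)     ∎))))
    where open ≡-Reasoning

split-ramsey-number : (k t : ℕ) → 1 ≤ t → t ≤ suc k →
  SplitRamseyNumberIs k (2 + k + t) (2 + k + t) (2 + k + t + (t + t))
split-ramsey-number k t 1≤t t≤1+k = upper-bound k t 1≤t , lower-bound k t t≤1+k

theorem6p3 : (k i : ℕ) → k + 3 ≤ i → i ≤ 2 * k + 2 →
    SplitRamseyNumberIs k i i (3 * i ∸ (2 * k + 4))
theorem6p3 k i k+3≤i i≤2k+2 with m≤n⇒∃[o]m+o≡n k+3≤i
... | d , refl = subst₂ (λ j N → SplitRamseyNumberIs k j j N) i≡ N≡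
  (split-ramsey-number k (suc d) (s≤s z≤n) (m≤n⇒m≤1+n t≤k))
  where
  i≡ : 2 + k + suc d ≡ k + 3 + d
  i≡ = solve (k ∷ˡ d ∷ˡ [])
  N≡ : 2 + k + suc d + (suc d + suc d) ≡ 3 * (k + 3 + d) ∸ (2 * k + 4)
  N≡ = trans (sym (m+n∸m≡n (2 * k + 4) _)) (cong (_∸ (2 * k + 4)) (solve (k ∷ˡ d ∷ˡ [])))
  t≤k : suc d ≤ k
  t≤k = +-cancelˡ-≤ (k + 2) (suc d) k (begin
    k + 2 + suc d       ≡⟨ solve (k ∷ˡ d ∷ˡ []) ⟩
    k + 3 + d           ≤⟨ i≤2k+2 ⟩
    2 * k + 2           ≡⟨ solve (k ∷ˡ []) ⟩
    k + 2 + k           ∎)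
    where open ≤-Reasoning
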